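{- Let $n\ge1$, $P\in\mathcal D_n$ and $\pi\in\mathfrak S_n(123)$. Then $\mathrm{Ri}(P)=\pi$ if and only if for all $i,a\in\{1,\dots,n\}$: $$(n+1-i,a)\in\mathrm{LMIN}(\pi)\iff(i,a)\in\mathrm{PEAK}(P).$$
   Context: Permutations are words $a_1\dots a_n$ with $a_i=\pi(i)$; $\mathfrak S_n(123)$ is the set of permutations with no $i<j<k$ such that $a_i<a_j<a_k$. $\mathrm{LMIN}(\pi)=\{(i,a_i): a_i<a_j\text{ for all }j<i\}$. $\mathcal D_n$ is the set of Dyck paths of semilength $n$ as words in $u,d$; index up-steps $u_1,\dots,u_n$ and down-steps $d_1,\dots,d_n$ from left to right, and let $\mathrm{PEAK}(P)=\{(i,j): u_i\text{ is immediately followed by }d_j\}$. Richards' map $\mathrm{Ri}:\mathcal D_n\to\mathfrak S_n(123)$ constructs $\pi=a_1\dots a_n$ by scanning the down-steps $d_1,\dots,d_n$ of $P$ from left to right: if $d_i$ is immediately preceded by an up-step $u_j$, set $a_{n+1-j}:=i$; otherwise (it is preceded by a down-step) let $j$ be the largest index for which $a_j$ is not yet set and set $a_j:=i$. For example, $\mathrm{Ri}(uudduududuuddd)=5743612$. -}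

module Defs where

open import Data.Nat using (ℕ; zero; suc; _+_; _∸_; _≤_; _<_)
open import Data.Empty using (⊥)
open import Data.Bool using (Bool; true; false)
open import Data.Maybe using (Maybe; just; nothing; fromMaybe)
open import Data.List using (List; []; _∷_; map; replicate; length; take; upTo)
open import Data.Product using (_×_; Σ; ∃-syntax)
open import Relation.Binary.PropositionalEquality using (_≡_)
open import Data.List.Relation.Binary.Permutation.Propositional using (_↭_)

-- Steps of a lattice path: u = up-step, d = down-step.
data Step : Set where
  u d : Step

#u : List Step → ℕ
#u [] = 0
#u (u ∷ w) = suc (#u w)
#u (d ∷ w) = #u w

#d : List Step → ℕ
#d [] = 0
#d (u ∷ w) = #d w
#d (d ∷ w) = suc (#d w)

IsDyck : ℕ → List Step → Set
IsDyck n w = (#u w ≡ n) × (#d w ≡ n) × (∀ k → #d (take k w) ≤ #u (take k w))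

-- 1-based lookup: at xs i = just xᵢ (i ∈ {1..length xs}), nothing otherwise
at : {A : Set} → List A → ℕ → Maybe A
at [] _ = nothing
at (x ∷ xs) zero = nothing
at (x ∷ xs) (suc zero) = just x
at (x ∷ xs) (suc (suc i)) = at xs (suc i)

-- π ∈ 𝔖ₙ : π is a rearrangement of the word 1 2 … n  (a π = a₁…aₙ, aᵢ = at π i)
IsPerm : ℕ → List ℕ → Set
IsPerm n π = π ↭ map suc (upTo n)

Avoids123 : List ℕ → Set
Avoids123 π = ∀ i j k ai aj ak → i < j → j < k →
  at π i ≡ just ai → at π j ≡ just aj → at π k ≡ just ak →
  ai < aj → aj < ak → ⊥

LMIN : List ℕ → ℕ → ℕ → Set
LMIN π i a = (at π i ≡ just a) ×
  (∀ j b → j < i → at π j ≡ just b → a < b)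

-- (i , j) ∈ PEAK(P) : the i-th up-step is immediately followed by the j-th down-step.
-- Position k (0-based) of the word carries u and position k+1 carries d; that u is
-- the (#u of the first k+1 letters)-th up-step and that d is the
-- (#d of the first k+2 letters)-th down-step.
PEAK : List Step → ℕ → ℕ → Set
PEAK w i j = ∃[ k ] ((at w (suc k) ≡ just u) × (at w (suc (suc k)) ≡ just d) ×
  (#u (take (suc k) w) ≡ i) × (#d (take (suc (suc k)) w) ≡ j))

-- Richards' map, computed on a state list of length n of partial values
-- (position p, 1-based, holds nothing if a_p is not yet set).
setAt : ℕ → ℕ → List (Maybe ℕ) → List (Maybe ℕ)
setAt _ v [] = []
setAt zero v (x ∷ xs) = x ∷ xs
setAt (suc zero) v (x ∷ xs) = just v ∷ xs
setAt (suc (suc p)) v (x ∷ xs) = x ∷ setAt (suc p) v xs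

-- largest (1-based) index p with a_p unset; `best` is the answer so far
lastUnsetFrom : ℕ → List (Maybe ℕ) → ℕ → ℕ
lastUnsetFrom idx [] best = best
lastUnsetFrom idx (nothing ∷ xs) best = lastUnsetFrom (suc idx) xs idx
lastUnsetFrom idx (just _ ∷ xs) best = lastUnsetFrom (suc idx) xs best

lastUnset : List (Maybe ℕ) → ℕ
lastUnset st = lastUnsetFrom 1 st 0

-- scan: n, was the previous step an up-step, #ups so far, #downs so far, rest, state
riGo : ℕ → Bool → ℕ → ℕ → List Step → List (Maybe ℕ) → List (Maybe ℕ)
riGo n prevUp ups downs [] st = st
riGo n prevUp ups downs (u ∷ w) st = riGo n true (suc ups) downs w st
-- d_{downs+1} immediately preceded by u_{ups}: set a_{n+1-ups}
riGo n true ups downs (d ∷ w) st =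
  riGo n false ups (suc downs) w (setAt (suc n ∸ ups) (suc downs) st)
-- d_{downs+1} preceded by a down-step: set a_j, j largest unset
riGo n false ups downs (d ∷ w) st =
  riGo n false ups (suc downs) w (setAt (lastUnset st) (suc downs) st)

Ri : ℕ → List Step → List ℕ
Ri n w = map (fromMaybe 0) (riGo n false 0 0 w (replicate n nothing))

-- Let reveal k π be π = a₁ … aₙ with only the values 1, …, k filled in. The k-th down-step of the
-- scan writes k, so the scan produces π exactly when its state after k down-steps is reveal k π.
-- A peak u_i d_k writes k at position n + 1 − i while all positions to its left are still empty,
-- i.e. hold values larger than k: peaks give left-to-right minima. A non-peak d_k writes to the
-- right of position n + 1 − i (already filled), since the Dyck condition leaves empty positions
-- from there on; so it never writes a minimum. Conversely, if the peaks are exactly the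
-- minima, a non-peak d_k finds k at a non-minimum position p; some smaller value lies left of p,
-- so by 123-avoidance no empty position (holding a value > k) lies right of p, and the scan, which
-- writes to the last empty position, writes k at p as well.

module Submission where

open import Defs
open import Data.Bool using (Bool; true; false)
open import Data.Empty using (⊥; ⊥-elim)
open import Data.List using (List; []; _∷_; drop; length; map; replicate; take; upTo)
open import Data.List.Properties using (length-map; length-upTo; map-∘; map-id)
open import Data.List.Membership.Propositional using (_∈_)
open import Data.List.Membership.Propositional.Properties using (∈-map⁺; ∈-map⁻; ∈-upTo⁺; ∈-upTo⁻)
open import Data.List.Relation.Unary.Any using (here; there)
import Data.List.Relation.Unary.All as All
open import Data.List.Relation.Unary.AllPairs using (_∷_)
open import Data.List.Relation.Unary.Unique.Propositional using (Unique)
import Data.List.Relation.Unary.Unique.Propositional.Properties as Unique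
open import Data.List.Relation.Binary.Permutation.Propositional using (↭-sym; ↭⇒↭ₛ)
open import Data.List.Relation.Binary.Permutation.Propositional.Properties using (↭-length; ∈-resp-↭)
import Data.List.Relation.Binary.Permutation.Setoid.Properties as ↭ₛ
open import Data.Maybe using (Maybe; just; nothing; fromMaybe)
import Data.Maybe as Maybe
open import Data.Maybe.Properties using (just-injective)
open import Data.Nat using (ℕ; zero; suc; _+_; _∸_; _≤_; _<_; z≤n; s≤s; z<s; s<s; _≟_; _≤?_; _<?_)
open import Data.Nat.Properties
open import Data.Product using (_,_; _×_; proj₁; proj₂; ∃-syntax)
open import Data.Sum using (_⊎_; inj₁; inj₂)
open import Data.Sum.Function.Propositional using (_⊎-⇔_)
open import Function.Base using (case_of_; _∘_)
open import Function.Bundles using (Equivalence; _⇔_; mk⇔)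
open import Function.Construct.Composition using (_⇔-∘_)
open import Function.Construct.Symmetry using (⇔-sym)
open import Relation.Binary.PropositionalEquality
open import Relation.Nullary using (yes; no; ¬_)

at₀ : {A : Set} → List A → ℕ → Maybe A
at₀ xs q = at xs (suc q)

at-zero : {A : Set} (xs : List A) {x : A} → at xs 0 ≢ just x
at-zero [] ()
at-zero (_ ∷ _) ()

at₀-∈ : {A : Set} (xs : List A) (q : ℕ) {x : A} → at₀ xs q ≡ just x → x ∈ xs
at₀-∈ [] q ()
at₀-∈ (y ∷ xs) zero refl = here refl
at₀-∈ (y ∷ xs) (suc q) e = there (at₀-∈ xs q e)

∈⇒at₀ : {A : Set} {xs : List A} {x : A} → x ∈ xs → ∃[ q ] (at₀ xs q ≡ just x)
∈⇒at₀ (here refl) = 0 , refl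
∈⇒at₀ (there x∈xs) with ∈⇒at₀ x∈xs
... | q , e = suc q , e

at₀-length : {A : Set} (xs : List A) (q : ℕ) {x : A} → at₀ xs q ≡ just x → q < length xs
at₀-length [] q ()
at₀-length (y ∷ xs) zero e = z<s
at₀-length (y ∷ xs) (suc q) e = s<s (at₀-length xs q e)

at₀-map : {A B : Set} (f : A → B) (xs : List A) (q : ℕ) → at₀ (map f xs) q ≡ Maybe.map f (at₀ xs q)
at₀-map f [] q = refl
at₀-map f (x ∷ xs) zero = refl
at₀-map f (x ∷ xs) (suc q) = at₀-map f xs q

at₀-ext : {A : Set} (xs ys : List A) → (∀ q → at₀ xs q ≡ at₀ ys q) → xs ≡ ys
at₀-ext [] [] eq = refl
at₀-ext [] (y ∷ ys) eq = case eq 0 of λ ()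
at₀-ext (x ∷ xs) [] eq = case eq 0 of λ ()
at₀-ext (x ∷ xs) (y ∷ ys) eq = cong₂ _∷_ (just-injective (eq 0)) (at₀-ext xs ys (eq ∘ suc))

Unique⇒at₀-injective : {A : Set} (xs : List A) → Unique xs →
  ∀ p q {x} → at₀ xs p ≡ just x → at₀ xs q ≡ just x → p ≡ q
Unique⇒at₀-injective [] _ p q ()
Unique⇒at₀-injective (y ∷ xs) (_ ∷ _) zero zero _ _ = refl
Unique⇒at₀-injective (y ∷ xs) (y∉xs ∷ _) zero (suc q) refl e =
  ⊥-elim (All.lookup y∉xs (at₀-∈ xs q e) refl)
Unique⇒at₀-injective (y ∷ xs) (y∉xs ∷ _) (suc p) zero e refl =
  ⊥-elim (All.lookup y∉xs (at₀-∈ xs p e) refl)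
Unique⇒at₀-injective (y ∷ xs) (_ ∷ uniq) (suc p) (suc q) e e′ =
  cong suc (Unique⇒at₀-injective xs uniq p q e e′)

record Permutation (n : ℕ) (π : List ℕ) : Set where
  field
    length≡ : length π ≡ n
    bounded : ∀ q x → at₀ π q ≡ just x → 1 ≤ x × x ≤ n
    injective : ∀ p q {x} → at₀ π p ≡ just x → at₀ π q ≡ just x → p ≡ q
    surjective : ∀ x → 1 ≤ x → x ≤ n → ∃[ p ] (at₀ π p ≡ just x)

IsPerm⇒Permutation : ∀ n π → IsPerm n π → Permutation n π
IsPerm⇒Permutation n π π↭ = record
  { length≡ = trans (↭-length π↭) (trans (length-map suc (upTo n)) (length-upTo n))
  ; bounded = bounded
  ; injective = Unique⇒at₀-injective π unique
  ; surjective = surjective }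
  where
  bounded : ∀ q x → at₀ π q ≡ just x → 1 ≤ x × x ≤ n
  bounded q x e with ∈-map⁻ suc (∈-resp-↭ π↭ (at₀-∈ π q e))
  ... | y , y∈ , refl = s≤s z≤n , ∈-upTo⁻ y∈
  surjective : ∀ x → 1 ≤ x → x ≤ n → ∃[ p ] (at₀ π p ≡ just x)
  surjective (suc x) _ x<n = ∈⇒at₀ (∈-resp-↭ (↭-sym π↭) (∈-map⁺ suc (∈-upTo⁺ x<n)))
  unique : Unique π
  unique = ↭ₛ.Unique-resp-↭ (setoid ℕ) (↭⇒↭ₛ (↭-sym π↭))
             (Unique.map⁺ suc-injective (Unique.upTo⁺ n))

GreaterBefore : List ℕ → ℕ → ℕ → Set
GreaterBefore π p a = ∀ q b → q < p → at₀ π q ≡ just b → a < b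

LeftMin₀ : List ℕ → ℕ → ℕ → Set
LeftMin₀ π p a = at₀ π p ≡ just a × GreaterBefore π p a

LMIN⇔LeftMin₀ : ∀ π p a → LMIN π (suc p) a ⇔ LeftMin₀ π p a
LMIN⇔LeftMin₀ π p a = mk⇔
  (λ (e , min) → e , λ q b q<p → min (suc q) b (s<s q<p))
  (λ (e , min) → e , λ { zero b _ e₀ → ⊥-elim (at-zero π e₀)
                       ; (suc q) b (s≤s q<p) → min q b q<p })

LMIN⇔LeftMin₀-from-end : ∀ {n i} π a → i ≤ n → LMIN π (suc n ∸ i) a ⇔ LeftMin₀ π (n ∸ i) a
LMIN⇔LeftMin₀-from-end {n} {i} π a i≤n
  rewrite +-∸-assoc 1 i≤n = LMIN⇔LeftMin₀ π (n ∸ i) a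

greaterBefore? : ∀ π p a → GreaterBefore π p a ⊎ ∃[ q ] ∃[ b ] (q < p × at₀ π q ≡ just b × b ≤ a)
greaterBefore? [] p a = inj₁ (λ _ _ _ ())
greaterBefore? (x ∷ π) zero a = inj₁ (λ _ _ ())
greaterBefore? (x ∷ π) (suc p) a with a <? x | greaterBefore? π p a
... | no a≮x | _ = inj₂ (0 , x , z<s , refl , ≮⇒≥ a≮x)
... | yes _ | inj₂ (q , b , q<p , e , b≤a) = inj₂ (suc q , b , s<s q<p , e , b≤a)
... | yes a<x | inj₁ greater = inj₁ λ { zero _ _ refl → a<x
                                      ; (suc q) b (s≤s q<p) e → greater q b q<p e }

State : Set
State = List (Maybe ℕ)

Unset : State → ℕ → Set
Unset st q = at₀ st q ≡ just nothing

SetAfter : State → ℕ → Set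
SetAfter st r = ∀ q → r < q → ¬ Unset st q

setAt-same : (st : State) (p : ℕ) {x : Maybe ℕ} (v : ℕ) →
  at₀ st p ≡ just x → at₀ (setAt (suc p) v st) p ≡ just (just v)
setAt-same [] p v ()
setAt-same (y ∷ st) zero v e = refl
setAt-same (y ∷ st) (suc p) v e = setAt-same st p v e

setAt-other : (st : State) (p q : ℕ) (v : ℕ) → q ≢ p → at₀ (setAt (suc p) v st) q ≡ at₀ st q
setAt-other [] p q v q≢p = refl
setAt-other (y ∷ st) zero zero v q≢p = ⊥-elim (q≢p refl)
setAt-other (y ∷ st) zero (suc q) v q≢p = refl
setAt-other (y ∷ st) (suc p) zero v q≢p = refl
setAt-other (y ∷ st) (suc p) (suc q) v q≢p = setAt-other st p q v (q≢p ∘ cong suc)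

setAt-cancel : (xs ys : State) (p v : ℕ) → at₀ xs p ≡ at₀ ys p →
  setAt (suc p) v xs ≡ setAt (suc p) v ys → xs ≡ ys
setAt-cancel xs ys p v agree eq = at₀-ext xs ys same
  where
  same : ∀ q → at₀ xs q ≡ at₀ ys q
  same q with q ≟ p
  ... | yes refl = agree
  ... | no q≢p = begin
    at₀ xs q                   ≡⟨ setAt-other xs p q v q≢p ⟨
    at₀ (setAt (suc p) v xs) q ≡⟨ cong (λ st → at₀ st q) eq ⟩
    at₀ (setAt (suc p) v ys) q ≡⟨ setAt-other ys p q v q≢p ⟩
    at₀ ys q                   ∎
    where open ≡-Reasoning

shownUpTo : ℕ → ℕ → Maybe ℕ
shownUpTo k x with x ≤? k
... | yes _ = just x
... | no _ = nothing

shownUpTo-≤ : ∀ {k x} → x ≤ k → shownUpTo k x ≡ just x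
shownUpTo-≤ {k} {x} x≤k with x ≤? k
... | yes _ = refl
... | no x≰k = ⊥-elim (x≰k x≤k)

shownUpTo-> : ∀ {k x} → k < x → shownUpTo k x ≡ nothing
shownUpTo-> {k} {x} k<x with x ≤? k
... | yes x≤k = ⊥-elim (<⇒≱ k<x x≤k)
... | no _ = refl

shownUpTo-just : ∀ {k x y} → shownUpTo k x ≡ just y → x ≡ y × x ≤ k
shownUpTo-just {k} {x} e with x ≤? k
shownUpTo-just refl | yes x≤k = refl , x≤k

shownUpTo-nothing : ∀ {k x} → shownUpTo k x ≡ nothing → k < x
shownUpTo-nothing {k} {x} e with x ≤? k
... | no x≰k = ≰⇒> x≰k

shownUpTo-suc : ∀ {k x} → x ≢ suc k → shownUpTo (suc k) x ≡ shownUpTo k x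
shownUpTo-suc {k} {x} x≢1+k with x ≤? k
... | yes x≤k = shownUpTo-≤ (m≤n⇒m≤1+n x≤k)
... | no x≰k = shownUpTo-> (≤∧≢⇒< (≰⇒> x≰k) (x≢1+k ∘ sym))

-- The state of Richards' scan after k down-steps, if the scan produces π.
reveal : ℕ → List ℕ → State
reveal k = map (shownUpTo k)

reveal-set : ∀ k π q {y} → at₀ (reveal k π) q ≡ just (just y) → at₀ π q ≡ just y × y ≤ k
reveal-set k π q e with at₀ π q | at₀-map (shownUpTo k) π q
... | nothing | e′ = case trans (sym e′) e of λ ()
... | just x | e′ with shownUpTo-just (just-injective (trans (sym e′) e))
... | refl , x≤k = refl , x≤k

reveal-unset : ∀ k π q → Unset (reveal k π) q → ∃[ x ] (at₀ π q ≡ just x × k < x)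
reveal-unset k π q e with at₀ π q | at₀-map (shownUpTo k) π q
... | nothing | e′ = case trans (sym e′) e of λ ()
... | just x | e′ = x , refl , shownUpTo-nothing (just-injective (trans (sym e′) e))

reveal-at : ∀ k π q {x} → at₀ π q ≡ just x → at₀ (reveal k π) q ≡ just (shownUpTo k x)
reveal-at k π q e = trans (at₀-map (shownUpTo k) π q) (cong (Maybe.map (shownUpTo k)) e)

reveal-none : ∀ π → (∀ q x → at₀ π q ≡ just x → 1 ≤ x) → reveal 0 π ≡ replicate (length π) nothing
reveal-none [] _ = refl
reveal-none (x ∷ π) positive =
  cong₂ _∷_ (shownUpTo-> (positive 0 x refl)) (reveal-none π (positive ∘ suc))

reveal-all : ∀ n π → (∀ q x → at₀ π q ≡ just x → x ≤ n) → reveal n π ≡ map just π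
reveal-all n [] _ = refl
reveal-all n (x ∷ π) bounded =
  cong₂ _∷_ (shownUpTo-≤ (bounded 0 x refl)) (reveal-all n π (bounded ∘ suc))

reveal-suc : ∀ k π q → at₀ π q ≢ just (suc k) → at₀ (reveal (suc k) π) q ≡ at₀ (reveal k π) q
reveal-suc k π q πq≢1+k rewrite at₀-map (shownUpTo (suc k)) π q | at₀-map (shownUpTo k) π q
  with at₀ π q
... | nothing = refl
... | just x = cong just (shownUpTo-suc (πq≢1+k ∘ cong just))

module _ {n : ℕ} {π : List ℕ} (perm : Permutation n π) where
  open Permutation perm

  reveal-step : ∀ {k r} → at₀ π r ≡ just (suc k) → setAt (suc r) (suc k) (reveal k π) ≡ reveal (suc k) π
  reveal-step {k} {r} πr = at₀-ext _ _ same
    where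
    same : ∀ q → at₀ (setAt (suc r) (suc k) (reveal k π)) q ≡ at₀ (reveal (suc k) π) q
    same q with q ≟ r
    ... | yes refl = trans (setAt-same (reveal k π) q (suc k) (reveal-at k π q πr))
                           (sym (trans (reveal-at (suc k) π q πr) (cong just (shownUpTo-≤ ≤-refl))))
    ... | no q≢r = begin
      at₀ (setAt (suc r) (suc k) (reveal k π)) q ≡⟨ setAt-other (reveal k π) r q (suc k) q≢r ⟩
      at₀ (reveal k π) q                         ≡⟨ reveal-suc k π q (λ πq → q≢r (injective q r πq πr)) ⟨
      at₀ (reveal (suc k) π) q                   ∎
      where open ≡-Reasoning

  reveal-unstep : ∀ {k r} st → Unset st r →
    setAt (suc r) (suc k) st ≡ reveal (suc k) π → st ≡ reveal k π
  reveal-unstep {k} {r} st unset eq = setAt-cancel st (reveal k π) r (suc k)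
    (trans unset (sym (trans (reveal-at k π r πr) (cong just (shownUpTo-> ≤-refl)))))
    (trans eq (sym (reveal-step πr)))
    where
    πr : at₀ π r ≡ just (suc k)
    πr = proj₁ (reveal-set (suc k) π r
           (trans (cong (λ st′ → at₀ st′ r) (sym eq)) (setAt-same st r (suc k) unset)))

record DyckSuffix (n ups downs : ℕ) (w : List Step) : Set where
  field
    ups+ : ups + #u w ≡ n
    downs+ : downs + #d w ≡ n
    balanced : ∀ k → downs + #d (take k w) ≤ ups + #u (take k w)

IsDyck⇒DyckSuffix : ∀ {n} w → IsDyck n w → DyckSuffix n 0 0 w
IsDyck⇒DyckSuffix w (ups , downs , balanced) = record { ups+ = ups ; downs+ = downs ; balanced = balanced }

module _ {n ups downs : ℕ} where

  suffix-u : ∀ {w} → DyckSuffix n ups downs (u ∷ w) → DyckSuffix n (suc ups) downs w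
  suffix-u {w} S = record
    { ups+ = trans (sym (+-suc ups (#u w))) ups+
    ; downs+ = downs+
    ; balanced = λ k → subst (downs + #d (take k w) ≤_) (+-suc ups _) (balanced (suc k)) }
    where open DyckSuffix S

  suffix-d : ∀ {w} → DyckSuffix n ups downs (d ∷ w) → DyckSuffix n ups (suc downs) w
  suffix-d {w} S = record
    { ups+ = ups+
    ; downs+ = trans (sym (+-suc downs (#d w))) downs+
    ; balanced = λ k → subst (_≤ ups + #u (take k w)) (+-suc downs _) (balanced (suc k)) }
    where open DyckSuffix S

  suffix-d-below : ∀ {w} → DyckSuffix n ups downs (d ∷ w) → suc downs ≤ ups
  suffix-d-below S = subst₂ _≤_ (+-comm downs 1) (+-identityʳ ups) (DyckSuffix.balanced S 1)

  suffix-ups≤ : ∀ {w} → DyckSuffix n ups downs w → ups ≤ n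
  suffix-ups≤ S = subst (ups ≤_) (DyckSuffix.ups+ S) (m≤m+n ups _)

  suffix-downs≤ : ∀ {w} → DyckSuffix n ups downs w → downs ≤ n
  suffix-downs≤ S = subst (downs ≤_) (DyckSuffix.downs+ S) (m≤m+n downs _)

  suffix-end : DyckSuffix n ups downs [] → downs ≡ n
  suffix-end S = trans (sym (+-identityʳ downs)) (DyckSuffix.downs+ S)

  suffix-position : ∀ {w} → DyckSuffix n ups downs w → n ∸ ups ≡ #u w
  suffix-position S = trans (cong (_∸ ups) (sym (DyckSuffix.ups+ S))) (m+n∸m≡n ups _)

-- Peak b ups downs w i a : (i , a) is a peak of the unread rest w of a word of which ups up-steps
-- and downs down-steps have been read, the last of them an up-step iff b (as in riGo).
Peak : Bool → ℕ → ℕ → List Step → ℕ → ℕ → Set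
Peak _ ups downs [] i a = ⊥
Peak _ ups downs (u ∷ w) i a = Peak true (suc ups) downs w i a
Peak true ups downs (d ∷ w) i a = (i ≡ ups × a ≡ suc downs) ⊎ Peak false ups (suc downs) w i a
Peak false ups downs (d ∷ w) i a = Peak false ups (suc downs) w i a

PEAKFrom : ℕ → ℕ → List Step → ℕ → ℕ → Set
PEAKFrom ups downs w i a = ∃[ k ] ((at₀ w k ≡ just u) × (at₀ w (suc k) ≡ just d) ×
  (ups + #u (take (suc k) w) ≡ i) × (downs + #d (take (suc (suc k)) w) ≡ a))

PeakAhead : Bool → ℕ → ℕ → List Step → ℕ → ℕ → Set
PeakAhead false ups downs w i a = PEAKFrom ups downs w i a
PeakAhead true ups downs w i a = (at₀ w 0 ≡ just d × i ≡ ups × a ≡ suc downs) ⊎ PEAKFrom ups downs w i a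

PEAKFrom-[] : ∀ {ups downs i a} → ¬ PEAKFrom ups downs [] i a
PEAKFrom-[] (k , () , _)

PEAKFrom-u→ : ∀ ups downs w {i a} → PEAKFrom ups downs (u ∷ w) i a → PeakAhead true (suc ups) downs w i a
PEAKFrom-u→ ups downs (d ∷ w) (zero , _ , _ , refl , refl) = inj₁ (refl , +-comm ups 1 , +-comm downs 1)
PEAKFrom-u→ ups downs (u ∷ w) (zero , _ , () , _)
PEAKFrom-u→ ups downs w (suc k , wk , wk+1 , refl , refl) = inj₂ (k , wk , wk+1 , sym (+-suc ups _) , refl)

PEAKFrom-u← : ∀ ups downs w {i a} → PeakAhead true (suc ups) downs w i a → PEAKFrom ups downs (u ∷ w) i a
PEAKFrom-u← ups downs (d ∷ w) (inj₁ (_ , refl , refl)) = zero , refl , refl , +-comm ups 1 , +-comm downs 1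
PEAKFrom-u← ups downs (u ∷ w) (inj₁ (() , _))
PEAKFrom-u← ups downs [] (inj₁ (() , _))
PEAKFrom-u← ups downs w (inj₂ (k , wk , wk+1 , refl , refl)) = suc k , wk , wk+1 , +-suc ups _ , refl

PEAKFrom-d : ∀ ups downs w {i a} → PEAKFrom ups (suc downs) w i a ⇔ PEAKFrom ups downs (d ∷ w) i a
PEAKFrom-d ups downs w = mk⇔
  (λ { (k , wk , wk+1 , refl , refl) → suc k , wk , wk+1 , refl , +-suc downs _ })
  (λ { (suc k , wk , wk+1 , refl , refl) → k , wk , wk+1 , refl , sym (+-suc downs _) })

PeakAhead-u : ∀ b ups downs w {i a} → PEAKFrom ups downs (u ∷ w) i a ⇔ PeakAhead b ups downs (u ∷ w) i a
PeakAhead-u false ups downs w = mk⇔ (λ p → p) (λ p → p)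
PeakAhead-u true ups downs w = mk⇔ inj₂ λ { (inj₁ (() , _)) ; (inj₂ p) → p }

Peak⇔PeakAhead : ∀ b ups downs w {i a} → Peak b ups downs w i a ⇔ PeakAhead b ups downs w i a
Peak⇔PeakAhead false ups downs [] = mk⇔ (λ ()) PEAKFrom-[]
Peak⇔PeakAhead true ups downs [] = mk⇔ (λ ()) λ { (inj₁ (() , _)) ; (inj₂ p) → PEAKFrom-[] p }
Peak⇔PeakAhead b ups downs (u ∷ w) =
  PeakAhead-u b ups downs w ⇔-∘ (mk⇔ (PEAKFrom-u← ups downs w) (PEAKFrom-u→ ups downs w)
    ⇔-∘ Peak⇔PeakAhead true (suc ups) downs w)
Peak⇔PeakAhead false ups downs (d ∷ w) = PEAKFrom-d ups downs w ⇔-∘ Peak⇔PeakAhead false ups (suc downs) w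
Peak⇔PeakAhead true ups downs (d ∷ w) =
  mk⇔ (λ (i≡ , a≡) → refl , i≡ , a≡) proj₂
    ⊎-⇔ (PEAKFrom-d ups downs w ⇔-∘ Peak⇔PeakAhead false ups (suc downs) w)

PEAK⇔Peak : ∀ w i a → PEAK w i a ⇔ Peak false 0 0 w i a
PEAK⇔Peak w i a = ⇔-sym (Peak⇔PeakAhead false 0 0 w)

peak-bounds : ∀ {n} b ups downs w {i a} → DyckSuffix n ups downs w → Peak b ups downs w i a →
  1 ≤ i × i ≤ n × downs < a × a ≤ n
peak-bounds b ups downs [] S ()
peak-bounds b ups downs (u ∷ w) S p = peak-bounds true (suc ups) downs w (suffix-u S) p
peak-bounds true ups downs (d ∷ w) S (inj₁ (refl , refl)) =
  ≤-trans (s≤s z≤n) (suffix-d-below S) , suffix-ups≤ S , ≤-refl , suffix-downs≤ (suffix-d S)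
peak-bounds true ups downs (d ∷ w) S (inj₂ p) with peak-bounds false ups (suc downs) w (suffix-d S) p
... | 1≤i , i≤n , downs<a , a≤n = 1≤i , i≤n , <⇒≤ downs<a , a≤n
peak-bounds false ups downs (d ∷ w) S p with peak-bounds false ups (suc downs) w (suffix-d S) p
... | 1≤i , i≤n , downs<a , a≤n = 1≤i , i≤n , <⇒≤ downs<a , a≤n

LastUnsetFrom : ℕ → State → ℕ → Set
LastUnsetFrom idx st best =
  ((∀ q → ¬ Unset st q) × lastUnsetFrom idx st best ≡ best) ⊎
  ∃[ r ] (lastUnsetFrom idx st best ≡ idx + r × Unset st r × SetAfter st r)

lastUnsetFrom-spec : ∀ idx st best → LastUnsetFrom idx st best
lastUnsetFrom-spec idx [] best = inj₁ ((λ q ()) , refl)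
lastUnsetFrom-spec idx (nothing ∷ st) best with lastUnsetFrom-spec (suc idx) st idx
... | inj₁ (none , e) = inj₂ (0 , trans e (sym (+-identityʳ idx)) , refl , λ { (suc q) _ → none q })
... | inj₂ (r , e , unset , after) =
  inj₂ (suc r , trans e (sym (+-suc idx r)) , unset , λ { (suc q) (s≤s r<q) → after q r<q })
lastUnsetFrom-spec idx (just x ∷ st) best with lastUnsetFrom-spec (suc idx) st best
... | inj₁ (none , e) = inj₁ ((λ { zero () ; (suc q) → none q }) , e)
... | inj₂ (r , e , unset , after) =
  inj₂ (suc r , trans e (sym (+-suc idx r)) , unset , λ { (suc q) (s≤s r<q) → after q r<q })

lastUnset-spec : ∀ st {q} → Unset st q → ∃[ r ] (lastUnset st ≡ suc r × Unset st r × SetAfter st r × q ≤ r)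
lastUnset-spec st {q} unset-q with lastUnsetFrom-spec 1 st 0
... | inj₁ (none , _) = ⊥-elim (none q unset-q)
... | inj₂ (r , e , unset , after) with q ≤? r
... | yes q≤r = r , e , unset , after , q≤r
... | no q≰r = ⊥-elim (after q (≰⇒> q≰r) unset-q)

lastUnset-last : ∀ st {r} → Unset st r → SetAfter st r → lastUnset st ≡ suc r
lastUnset-last st {r} unset after with lastUnset-spec st unset
... | r′ , e , unset′ , _ , r≤r′ with m≤n⇒m<n∨m≡n r≤r′
... | inj₁ r<r′ = ⊥-elim (after r′ r<r′ unset′)
... | inj₂ refl = e

module _ {n : ℕ} {π : List ℕ} (perm : Permutation n π) (avoids : Avoids123 π) where
  open Permutation perm

  lastUnset-reveal : ∀ {k p} → at₀ π p ≡ just (suc k) → ¬ LeftMin₀ π p (suc k) →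
    lastUnset (reveal k π) ≡ suc p
  lastUnset-reveal {k} {p} πp not-min with greaterBefore? π p (suc k)
  ... | inj₁ greater = ⊥-elim (not-min (πp , greater))
  ... | inj₂ (j , b , j<p , πj , b≤k+1) = lastUnset-last (reveal k π)
        (trans (reveal-at k π p πp) (cong just (shownUpTo-> ≤-refl))) after
    where
    b<k+1 : b < suc k
    b<k+1 = ≤∧≢⇒< b≤k+1 λ { refl → <-irrefl (injective j p πj πp) j<p }
    after : SetAfter (reveal k π) p
    after q p<q unset with reveal-unset k π q unset
    ... | x , πq , k<x = avoids (suc j) (suc p) (suc q) b (suc k) x (s<s j<p) (s<s p<q) πj πp πq b<k+1
          (≤∧≢⇒< k<x λ { refl → <-irrefl (injective p q πp πq) p<q })

  reveal-run : ∀ b ups downs w → DyckSuffix n ups downs w →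
    (∀ {i a} → Peak b ups downs w i a → LeftMin₀ π (n ∸ i) a) →
    (∀ {i a} → 1 ≤ i → i ≤ n → downs < a → LeftMin₀ π (n ∸ i) a → Peak b ups downs w i a) →
    riGo n b ups downs w (reveal downs π) ≡ reveal n π
  reveal-run b ups downs [] S _ _ = cong (λ k → reveal k π) (suffix-end S)
  reveal-run b ups downs (u ∷ w) S sound complete =
    reveal-run true (suc ups) downs w (suffix-u S) sound complete
  reveal-run true ups downs (d ∷ w) S sound complete = begin
    continue (setAt (suc n ∸ ups) (suc downs) (reveal downs π))
      ≡⟨ cong (λ r → continue (setAt r (suc downs) (reveal downs π))) (+-∸-assoc 1 (suffix-ups≤ S)) ⟩
    continue (setAt (suc (n ∸ ups)) (suc downs) (reveal downs π))
      ≡⟨ cong continue (reveal-step perm (proj₁ (sound (inj₁ (refl , refl))))) ⟩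
    continue (reveal (suc downs) π)
      ≡⟨ reveal-run false ups (suc downs) w (suffix-d S) (sound ∘ inj₂) complete′ ⟩
    reveal n π ∎
    where
    open ≡-Reasoning
    continue : State → State
    continue = riGo n false ups (suc downs) w
    complete′ : ∀ {i a} → 1 ≤ i → i ≤ n → suc downs < a → LeftMin₀ π (n ∸ i) a →
      Peak false ups (suc downs) w i a
    complete′ 1≤i i≤n downs<a min with complete 1≤i i≤n (<⇒≤ downs<a) min
    ... | inj₁ (_ , refl) = ⊥-elim (<-irrefl refl downs<a)
    ... | inj₂ peak = peak
  reveal-run false ups downs (d ∷ w) S sound complete = begin
    continue (setAt (lastUnset (reveal downs π)) (suc downs) (reveal downs π))
      ≡⟨ cong (λ r → continue (setAt r (suc downs) (reveal downs π))) (lastUnset-reveal πp not-min) ⟩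
    continue (setAt (suc p) (suc downs) (reveal downs π))
      ≡⟨ cong continue (reveal-step perm πp) ⟩
    continue (reveal (suc downs) π)
      ≡⟨ reveal-run false ups (suc downs) w (suffix-d S) sound (λ 1≤i i≤n → complete 1≤i i≤n ∘ <⇒≤) ⟩
    reveal n π ∎
    where
    open ≡-Reasoning
    continue : State → State
    continue = riGo n false ups (suc downs) w
    position : ∃[ p ] (at₀ π p ≡ just (suc downs))
    position = surjective (suc downs) (s≤s z≤n) (suffix-downs≤ (suffix-d S))
    p : ℕ
    p = proj₁ position
    πp : at₀ π p ≡ just (suc downs)
    πp = proj₂ position
    p<n : p < n
    p<n = subst (p <_) length≡ (at₀-length π p πp)
    not-min : ¬ LeftMin₀ π p (suc downs)
    not-min min = <-irrefl refl (proj₁ (proj₂ (proj₂ (peak-bounds false ups (suc downs) w (suffix-d S) peak))))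
      where
      peak : Peak false ups (suc downs) w (n ∸ p) (suc downs)
      peak = complete (m<n⇒0<n∸m p<n) (m∸n≤m n p) ≤-refl
               (subst (λ q → LeftMin₀ π q (suc downs)) (sym (m∸[m∸n]≡n (<⇒≤ p<n))) min)

  Ri-from-minima : ∀ P → IsDyck n P →
    (∀ i a → 1 ≤ i → i ≤ n → 1 ≤ a → a ≤ n → LeftMin₀ π (n ∸ i) a ⇔ Peak false 0 0 P i a) →
    Ri n P ≡ π
  Ri-from-minima P dyck minima⇔peaks = begin
    map (fromMaybe 0) (riGo n false 0 0 P (replicate n nothing))
      ≡⟨ cong (λ st → map (fromMaybe 0) (riGo n false 0 0 P st)) start ⟩
    map (fromMaybe 0) (riGo n false 0 0 P (reveal 0 π))
      ≡⟨ cong (map (fromMaybe 0)) (reveal-run false 0 0 P suffix sound complete) ⟩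
    map (fromMaybe 0) (reveal n π)
      ≡⟨ cong (map (fromMaybe 0)) (reveal-all n π (λ q x → proj₂ ∘ bounded q x)) ⟩
    map (fromMaybe 0) (map just π)
      ≡⟨ map-∘ π ⟨
    map (λ x → x) π
      ≡⟨ map-id π ⟩
    π ∎
    where
    open ≡-Reasoning
    start : replicate n nothing ≡ reveal 0 π
    start = sym (trans (reveal-none π (λ q x → proj₁ ∘ bounded q x))
                       (cong (λ m → replicate m nothing) length≡))
    suffix : DyckSuffix n 0 0 P
    suffix = IsDyck⇒DyckSuffix P dyck
    sound : ∀ {i a} → Peak false 0 0 P i a → LeftMin₀ π (n ∸ i) a
    sound peak with peak-bounds false 0 0 P suffix peak
    ... | 1≤i , i≤n , 1≤a , a≤n = Equivalence.from (minima⇔peaks _ _ 1≤i i≤n 1≤a a≤n) peak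
    complete : ∀ {i a} → 1 ≤ i → i ≤ n → 0 < a → LeftMin₀ π (n ∸ i) a → Peak false 0 0 P i a
    complete {i} {a} 1≤i i≤n 1≤a min@(πn∸i , _) =
      Equivalence.to (minima⇔peaks i a 1≤i i≤n 1≤a (proj₂ (bounded (n ∸ i) a πn∸i))) min

#unset : State → ℕ
#unset [] = 0
#unset (nothing ∷ st) = suc (#unset st)
#unset (just _ ∷ st) = #unset st

drop-at₀ : {A : Set} (xs : List A) (k : ℕ) {x : A} → at₀ xs k ≡ just x → drop k xs ≡ x ∷ drop (suc k) xs
drop-at₀ [] k ()
drop-at₀ (y ∷ xs) zero refl = refl
drop-at₀ (y ∷ xs) (suc k) e = drop-at₀ xs k e

#unset-setAt : ∀ (st : State) p v → Unset st p → suc (#unset (setAt (suc p) v st)) ≡ #unset st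
#unset-setAt (nothing ∷ st) zero v _ = refl
#unset-setAt (nothing ∷ st) (suc p) v e = cong suc (#unset-setAt st p v e)
#unset-setAt (just _ ∷ st) (suc p) v e = #unset-setAt st p v e

#unset-drop-setAt : ∀ (st : State) k p v → Unset st p → k ≤ p →
  suc (#unset (drop k (setAt (suc p) v st))) ≡ #unset (drop k st)
#unset-drop-setAt st zero p v e _ = #unset-setAt st p v e
#unset-drop-setAt (x ∷ st) (suc k) (suc p) v e (s≤s k≤p) = #unset-drop-setAt st k p v e k≤p

#unset-drop-pos : ∀ (st : State) k → 0 < #unset (drop k st) → ∃[ p ] (k ≤ p × Unset st p)
#unset-drop-pos (nothing ∷ st) zero _ = 0 , z≤n , refl
#unset-drop-pos (just _ ∷ st) zero pos with #unset-drop-pos st zero pos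
... | p , _ , e = suc p , z≤n , e
#unset-drop-pos (x ∷ st) (suc k) pos with #unset-drop-pos st k pos
... | p , k≤p , e = suc p , s≤s k≤p , e

replicate-unset : ∀ n q → q < n → Unset (replicate n nothing) q
replicate-unset (suc n) zero _ = refl
replicate-unset (suc n) (suc q) (s≤s q<n) = replicate-unset n q q<n

#unset-drop-replicate : ∀ n → #unset (drop n (replicate n nothing)) ≡ 0
#unset-drop-replicate zero = refl
#unset-drop-replicate (suc n) = #unset-drop-replicate n

lastUnset-from : ∀ st k → 0 < #unset (drop k st) → ∃[ r ] (lastUnset st ≡ suc r × Unset st r × k ≤ r)
lastUnset-from st k some-unset with #unset-drop-pos st k some-unset
... | q , k≤q , unset-q with lastUnset-spec st unset-q
... | r , e , unset-r , _ , q≤r = r , e , unset-r , ≤-trans k≤q q≤r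

LastStep : Bool → ℕ → Maybe (Maybe ℕ) → Set
LastStep true ups entry = entry ≡ just nothing
LastStep false ups entry = ups ≡ 0 ⊎ ∃[ x ] (entry ≡ just (just x))

-- #u w = n ∸ ups is the position of a_{n+1-ups}, where the up-step u_ups puts its peak value.
record Invariant (n : ℕ) (b : Bool) (ups downs : ℕ) (w : List Step) (st : State) : Set where
  field
    suffix : DyckSuffix n ups downs w
    unset-before : ∀ q → q < #u w → Unset st q
    unset-count : #unset (drop (#u w) st) + downs ≡ ups
    last-step : LastStep b ups (at₀ st (#u w))

Invariant-initial : ∀ n P → IsDyck n P → Invariant n false 0 0 P (replicate n nothing)
Invariant-initial n P dyck@(ups , _ , _) = record
  { suffix = IsDyck⇒DyckSuffix P dyck
  ; unset-before = λ q q<ups → replicate-unset n q (subst (q <_) ups q<ups)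
  ; unset-count = trans (+-identityʳ _)
      (trans (cong (λ k → #unset (drop k (replicate n nothing))) ups) (#unset-drop-replicate n))
  ; last-step = inj₁ refl }

Invariant-u : ∀ {n b ups downs w st} → Invariant n b ups downs (u ∷ w) st → Invariant n true (suc ups) downs w st
Invariant-u {downs = downs} {w} {st} I = record
  { suffix = suffix-u suffix
  ; unset-before = λ q q<#u → unset-before q (m<n⇒m<1+n q<#u)
  ; unset-count =
      trans (cong (λ rest → #unset rest + downs) (drop-at₀ st (#u w) next-unset)) (cong suc unset-count)
  ; last-step = next-unset }
  where
  open Invariant I
  next-unset : Unset st (#u w)
  next-unset = unset-before (#u w) (n<1+n _)

Invariant-write : ∀ {n b ups downs w st} → Invariant n b ups downs (d ∷ w) st →
  ∀ r → #u w ≤ r → Unset st r →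
  LastStep false ups (at₀ (setAt (suc r) (suc downs) st) (#u w)) →
  Invariant n false ups (suc downs) w (setAt (suc r) (suc downs) st)
Invariant-write {downs = downs} {w} {st} I r #u≤r unset last = record
  { suffix = suffix-d suffix
  ; unset-before = λ q q<#u →
      trans (setAt-other st r q (suc downs) (<⇒≢ (<-≤-trans q<#u #u≤r))) (unset-before q q<#u)
  ; unset-count = trans (+-suc _ downs)
      (trans (cong (_+ downs) (#unset-drop-setAt st (#u w) r (suc downs) unset #u≤r)) unset-count)
  ; last-step = last }
  where open Invariant I

Invariant-some-unset : ∀ {n b ups downs w st} → Invariant n b ups downs (d ∷ w) st →
  0 < #unset (drop (#u w) st)
Invariant-some-unset {downs = downs} I =
  +-cancelʳ-< downs 0 _ (subst (downs <_) (sym unset-count) (suffix-d-below suffix))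
  where open Invariant I

WriteKind : Bool → List Step → State → ℕ → Set
WriteKind true w st r = r ≡ #u w
WriteKind false w st r = #u w < r × ∃[ x ] (at₀ st (#u w) ≡ just (just x))

record DownStep (n : ℕ) (b : Bool) (ups downs : ℕ) (w : List Step) (st : State) : Set where
  field
    pos : ℕ
    unset : Unset st pos
    step : riGo n b ups downs (d ∷ w) st ≡ riGo n false ups (suc downs) w (setAt (suc pos) (suc downs) st)
    next : Invariant n false ups (suc downs) w (setAt (suc pos) (suc downs) st)
    kind : WriteKind b w st pos

downStep : ∀ {n} b {ups downs w st} → Invariant n b ups downs (d ∷ w) st → DownStep n b ups downs w st
downStep {n} true {ups} {downs} {w} {st} I = record
  { pos = #u w
  ; unset = last-step
  ; step = cong (λ r → riGo n false ups (suc downs) w (setAt r (suc downs) st))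
      (trans (+-∸-assoc 1 (suffix-ups≤ suffix)) (cong suc (suffix-position suffix)))
  ; next = Invariant-write I (#u w) ≤-refl last-step
      (inj₂ (suc downs , setAt-same st (#u w) (suc downs) last-step))
  ; kind = refl }
  where open Invariant I
downStep {n} false {ups} {downs} {w} {st} I
  with Invariant.last-step I | lastUnset-from st (#u w) (Invariant-some-unset I)
... | inj₁ refl | _ = case suffix-d-below (Invariant.suffix I) of λ ()
... | inj₂ (x , at-#u) | r , lastUnset≡ , unset-r , #u≤r = record
  { pos = r
  ; unset = unset-r
  ; step = cong (λ r → riGo n false ups (suc downs) w (setAt r (suc downs) st)) lastUnset≡
  ; next = Invariant-write I r #u≤r unset-r
      (inj₂ (x , trans (setAt-other st r (#u w) (suc downs) (<⇒≢ #u<r)) at-#u))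
  ; kind = #u<r , x , at-#u }
  where
  #u<r : #u w < r
  #u<r = ≤∧≢⇒< #u≤r λ #u≡r → case trans (sym at-#u) (trans (cong (at₀ st) #u≡r) unset-r) of λ ()

map-fromMaybe⇒map-just : ∀ (st : State) π → (∀ q x → at₀ π q ≡ just x → 1 ≤ x) →
  map (fromMaybe 0) st ≡ π → st ≡ map just π
map-fromMaybe⇒map-just [] [] _ _ = refl
map-fromMaybe⇒map-just (nothing ∷ st) (x ∷ π) positive refl = case positive 0 0 refl of λ ()
map-fromMaybe⇒map-just (just y ∷ st) (x ∷ π) positive refl =
  cong (just y ∷_) (map-fromMaybe⇒map-just st π (positive ∘ suc) refl)

Peak-d-later : ∀ b {ups downs w i a} → Peak false ups (suc downs) w i a → Peak b ups downs (d ∷ w) i a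
Peak-d-later true = inj₂
Peak-d-later false peak = peak

module _ {n : ℕ} {π : List ℕ} (perm : Permutation n π) where
  open Permutation perm

  Run : Bool → ℕ → ℕ → List Step → State → Set
  Run b ups downs w st = riGo n b ups downs w st ≡ reveal n π

  reveals : ∀ b ups downs w st → Invariant n b ups downs w st → Run b ups downs w st → st ≡ reveal downs π
  reveals b ups downs [] st I run = trans run (cong (λ k → reveal k π) (sym (suffix-end (Invariant.suffix I))))
  reveals b ups downs (u ∷ w) st I run = reveals true (suc ups) downs w st (Invariant-u I) run
  reveals b ups downs (d ∷ w) st I run =
    reveal-unstep perm st unset (reveals false ups (suc downs) w _ next (trans (sym step) run))
    where open DownStep (downStep b I)

  written : ∀ b {ups downs w st} (I : Invariant n b ups downs (d ∷ w) st) → Run b ups downs (d ∷ w) st →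
    at₀ π (DownStep.pos (downStep b I)) ≡ just (suc downs)
  written b {ups} {downs} {w} {st} I run = proj₁ (reveal-set (suc downs) π pos
    (trans (cong (λ st′ → at₀ st′ pos) (sym revealed)) (setAt-same st pos (suc downs) unset)))
    where
    open DownStep (downStep b I)
    revealed : setAt (suc pos) (suc downs) st ≡ reveal (suc downs) π
    revealed = reveals false ups (suc downs) w _ next (trans (sym step) run)

  unset⇒greater : ∀ {k st q x} → st ≡ reveal k π → Unset st q → at₀ π q ≡ just x → k < x
  unset⇒greater {k} {q = q} refl unset πq with reveal-unset k π q unset
  ... | x , πq′ , k<x with trans (sym πq) πq′
  ... | refl = k<x

  peak⇒leftMin : ∀ b ups downs w st {i a} → Invariant n b ups downs w st → Run b ups downs w st →
    Peak b ups downs w i a → LeftMin₀ π (n ∸ i) a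
  peak⇒leftMin b ups downs [] st I run ()
  peak⇒leftMin b ups downs (u ∷ w) st I run peak = peak⇒leftMin true (suc ups) downs w st (Invariant-u I) run peak
  peak⇒leftMin false ups downs (d ∷ w) st I run peak =
    peak⇒leftMin false ups (suc downs) w _ next (trans (sym step) run) peak
    where open DownStep (downStep false I)
  peak⇒leftMin true ups downs (d ∷ w) st I run (inj₂ peak) =
    peak⇒leftMin false ups (suc downs) w _ next (trans (sym step) run) peak
    where open DownStep (downStep true I)
  peak⇒leftMin true ups downs (d ∷ w) st I run (inj₁ (refl , refl)) =
    subst (λ p → LeftMin₀ π p (suc downs)) (sym position) (πpos , greater)
    where
    open Invariant I
    open DownStep (downStep true I)
    position : n ∸ ups ≡ pos
    position = trans (suffix-position suffix) (sym kind)
    πpos : at₀ π pos ≡ just (suc downs)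
    πpos = written true I run
    greater : GreaterBefore π pos (suc downs)
    greater q x q<pos πq = ≤∧≢⇒< (unset⇒greater (reveals true ups downs (d ∷ w) st I run)
                                   (unset-before q (subst (q <_) kind q<pos)) πq)
                                 λ { refl → <-irrefl (injective q pos πq πpos) q<pos }

  leftMin-here⇒peak : ∀ b {ups downs w st i} →
    Invariant n b ups downs (d ∷ w) st → Run b ups downs (d ∷ w) st →
    i ≤ n → LeftMin₀ π (n ∸ i) (suc downs) → Peak b ups downs (d ∷ w) i (suc downs)
  leftMin-here⇒peak true {ups} {w = w} {i = i} I run i≤n (πn∸i , _) = inj₁ (i≡ups , refl)
    where
    open DownStep (downStep true I)
    S : DyckSuffix n ups _ (d ∷ w)
    S = Invariant.suffix I
    i≡ups : i ≡ ups
    i≡ups = ∸-cancelˡ-≡ i≤n (suffix-ups≤ S) (begin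
      n ∸ i   ≡⟨ injective (n ∸ i) pos πn∸i (written true I run) ⟩
      pos     ≡⟨ kind ⟩
      #u w    ≡⟨ suffix-position S ⟨
      n ∸ ups ∎)
      where open ≡-Reasoning
  leftMin-here⇒peak false {ups} {downs} {w} {st} {i} I run i≤n (πn∸i , greater) = ⊥-elim (descent kind)
    where
    open DownStep (downStep false I)
    descent : WriteKind false w st pos → ⊥
    descent (#u<pos , x , st-#u) with reveal-set downs π (#u w)
      (subst (λ st′ → at₀ st′ (#u w) ≡ just (just x)) (reveals false ups downs (d ∷ w) st I run) st-#u)
    ... | π-#u , x≤downs = <⇒≱ (greater (#u w) x #u<n∸i π-#u) (m≤n⇒m≤1+n x≤downs)
      where
      #u<n∸i : #u w < n ∸ i
      #u<n∸i = subst (#u w <_) (sym (injective (n ∸ i) pos πn∸i (written false I run))) #u<pos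

  leftMin⇒peak : ∀ b ups downs w st {i a} → Invariant n b ups downs w st → Run b ups downs w st →
    i ≤ n → downs < a → LeftMin₀ π (n ∸ i) a → Peak b ups downs w i a
  leftMin⇒peak b ups downs [] st {i} {a} I run i≤n downs<a (πn∸i , _) =
    ⊥-elim (<⇒≱ downs<a (subst (a ≤_) (sym (suffix-end (Invariant.suffix I)))
                                (proj₂ (bounded (n ∸ i) a πn∸i))))
  leftMin⇒peak b ups downs (u ∷ w) st I run = leftMin⇒peak true (suc ups) downs w st (Invariant-u I) run
  leftMin⇒peak b ups downs (d ∷ w) st {a = a} I run i≤n downs<a min with a ≟ suc downs
  ... | yes refl = leftMin-here⇒peak b I run i≤n min
  ... | no a≢1+downs = Peak-d-later b
          (leftMin⇒peak false ups (suc downs) w _ next (trans (sym step) run)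
             i≤n (≤∧≢⇒< downs<a (a≢1+downs ∘ sym)) min)
    where open DownStep (downStep b I)

  minima-from-Ri : ∀ P → IsDyck n P → Ri n P ≡ π →
    ∀ i a → i ≤ n → 1 ≤ a → LeftMin₀ π (n ∸ i) a ⇔ Peak false 0 0 P i a
  minima-from-Ri P dyck Ri≡π i a i≤n 1≤a =
    mk⇔ (leftMin⇒peak false 0 0 P _ initial run i≤n 1≤a) (peak⇒leftMin false 0 0 P _ initial run)
    where
    initial : Invariant n false 0 0 P (replicate n nothing)
    initial = Invariant-initial n P dyck
    run : Run false 0 0 P (replicate n nothing)
    run = trans (map-fromMaybe⇒map-just _ π (λ q x → proj₁ ∘ bounded q x) Ri≡π)
                (sym (reveal-all n π (λ q x → proj₂ ∘ bounded q x)))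

lemma7 : (n : ℕ) → 1 ≤ n → (P : List Step) → IsDyck n P →
    (π : List ℕ) → IsPerm n π → Avoids123 π →
    (Ri n P ≡ π) ⇔
      (∀ i a → 1 ≤ i → i ≤ n → 1 ≤ a → a ≤ n →
        (LMIN π (suc n ∸ i) a ⇔ PEAK P i a))
lemma7 n _ P dyck π π↭ avoids = mk⇔
  (λ Ri≡π i a _ i≤n 1≤a _ → from₀ i a i≤n (minima-from-Ri perm P dyck Ri≡π i a i≤n 1≤a))
  (λ minima⇔peaks → Ri-from-minima perm avoids P dyck
     λ i a 1≤i i≤n 1≤a a≤n → to₀ i a i≤n (minima⇔peaks i a 1≤i i≤n 1≤a a≤n))
  where
  perm : Permutation n π
  perm = IsPerm⇒Permutation n π π↭
  to₀ : ∀ i a → i ≤ n →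
    LMIN π (suc n ∸ i) a ⇔ PEAK P i a → LeftMin₀ π (n ∸ i) a ⇔ Peak false 0 0 P i a
  to₀ i a i≤n e = PEAK⇔Peak P i a ⇔-∘ (e ⇔-∘ ⇔-sym (LMIN⇔LeftMin₀-from-end π a i≤n))
  from₀ : ∀ i a → i ≤ n →
    LeftMin₀ π (n ∸ i) a ⇔ Peak false 0 0 P i a → LMIN π (suc n ∸ i) a ⇔ PEAK P i a
  from₀ i a i≤n e = ⇔-sym (PEAK⇔Peak P i a) ⇔-∘ (e ⇔-∘ LMIN⇔LeftMin₀-from-end π a i≤n)
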